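{- Let $u$ and $v$ be words in $\mathbf c,\mathbf d$ (possibly empty). Then $\beta(u\mathbf d v)\ge\beta(u\mathbf c^2v)$, with equality if $u$ and $v$ are both empty.
   Context: $\deg\mathbf c=1$, $\deg\mathbf d=2$. For a graded poset $P$ of rank $n+1$ with $\hat0,\hat1$ and $S\subseteq[n]$, $f_S$ counts chains $\hat0<x_1<\dots<x_j<\hat1$ with rank set $S$, $h_S=\sum_{T\subseteq S}(-1)^{|S-T|}f_T$, and the ab-index is $\sum_S h_S u_1\cdots u_n$ with $u_i=\mathbf b$ if $i\in S$, $\mathbf a$ otherwise. For Eulerian $P$ it is uniquely a polynomial $\Psi(P)$ in $\mathbf c=\mathbf a+\mathbf b$, $\mathbf d=\mathbf a\mathbf b+\mathbf b\mathbf a$ (the cd-index). $B_{n+1}$ is the Boolean lattice of subsets of $[n+1]$. For a word $v$ of degree $n$, $\beta(v)$ is the coefficient of $v$ in $\Psi(B_{n+1})$. -}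

module Defs where

open import Data.Nat using (ℕ; zero; suc; _∸_; _≟_)
open import Data.Bool using (Bool; true; false)
open import Data.Integer as ℤ using (ℤ; +_; -_; _*_; _+_)
open import Data.List using (List; []; _∷_; map; filter; _++_; foldr)
open import Data.Vec using (Vec; []; _∷_)
open import Data.Fin.Subset using (Subset; ∣_∣; ⊥; inside; outside)
open import Data.Fin.Subset.Properties using (_⊆?_)
open import Data.Product using (_×_; _,_)
open import Relation.Nullary.Decidable using (_×-dec_)
open import Relation.Binary.PropositionalEquality using (_≡_)

allSubsets : (m : ℕ) → List (Subset m)
allSubsets zero    = [] ∷ []
allSubsets (suc m) = map (outside ∷_) (allSubsets m) ++ map (inside ∷_) (allSubsets m)

sumℕ : List ℕ → ℕ
sumℕ = foldr Data.Nat._+_ 0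

sumℤ : List ℤ → ℤ
sumℤ = foldr _+_ (+ 0)

-- Flag f-vector of the Boolean lattice B_{n+1}
-- (elements = subsets of Fin (n+1), order = inclusion, rank = cardinality).
-- A set S ⊆ [n] is encoded as Vec Bool n; position i (0-based) ↔ rank i+1.

rankList : ∀ {n} → ℕ → Vec Bool n → List ℕ
rankList k []           = []
rankList k (true  ∷ s)  = suc k ∷ rankList (suc k) s
rankList k (false ∷ s)  = rankList (suc k) s

chainsAbove : (m : ℕ) → Subset m → List ℕ → ℕ
chainsAbove m x []       = 1
chainsAbove m x (s ∷ ss) =
  sumℕ (map (λ y → chainsAbove m y ss)
            (filter (λ y → (∣ y ∣ ≟ s) ×-dec (x ⊆? y)) (allSubsets m)))

flagF : (n : ℕ) → Vec Bool n → ℕ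
flagF n S = chainsAbove (suc n) ⊥ (rankList 0 S)

subsetsOf : ∀ {n} → Vec Bool n → List (Vec Bool n)
subsetsOf {n} S = filter (λ T → T ⊆? S) (allSubsets n)

sign : ℕ → ℤ
sign zero    = + 1
sign (suc k) = - sign k

flagH : (n : ℕ) → Vec Bool n → ℤ
flagH n S = sumℤ (map (λ T → sign (∣ S ∣ ∸ ∣ T ∣) * + flagF n T) (subsetsOf S))

data AB : Set where
  a b : AB

abToSet : ∀ {n} → Vec AB n → Vec Bool n
abToSet []      = []
abToSet (a ∷ w) = false ∷ abToSet w
abToSet (b ∷ w) = true  ∷ abToSet w

-- coefficient of the ab-word w (u_i = b iff i ∈ S) in the ab-index of B_{n+1}
abIndexB : (n : ℕ) → Vec AB n → ℤ
abIndexB n w = flagH n (abToSet w)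

data CD : Set where
  c d : CD

deg : List CD → ℕ
deg []      = 0
deg (c ∷ v) = suc (deg v)
deg (d ∷ v) = suc (suc (deg v))

cdWords : ℕ → List (List CD)
cdWords zero          = [] ∷ []
cdWords (suc zero)    = (c ∷ []) ∷ []
cdWords (suc (suc n)) = map (c ∷_) (cdWords (suc n)) ++ map (d ∷_) (cdWords n)

expCoeff : ∀ {n} → List CD → Vec AB n → ℤ
expCoeff []      []          = + 1
expCoeff (c ∷ v) (_ ∷ w)     = expCoeff v w
expCoeff (d ∷ v) (a ∷ b ∷ w) = expCoeff v w
expCoeff (d ∷ v) (b ∷ a ∷ w) = expCoeff v w
expCoeff _       _           = + 0

expandCD : (n : ℕ) → (List CD → ℤ) → Vec AB n → ℤ
expandCD n ψ w = sumℤ (map (λ v → ψ v * expCoeff v w) (cdWords n))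

-- ψ is the cd-index of B_{n+1}: its ab-expansion equals the ab-index of B_{n+1}.
-- (Such ψ exists and is unique on words of degree n; β(v) = ψ v.)
IsCDIndexB : (n : ℕ) → (List CD → ℤ) → Set
IsCDIndexB n ψ = ∀ (w : Vec AB n) → expandCD n ψ w ≡ abIndexB n w

-- Ψ(B_{n+1}) is computed by the recursion Ψ(B_{n+2}) = c·Ψ(B_{n+1}) + G(Ψ(B_{n+1})), where G is
-- the derivation with G(c) = d and G(d) = dc. Its coefficients are natural numbers, and the
-- property "replacing cc by d never decreases a coefficient" passes from F to cF + G(F): an
-- induction on the position of the replaced cc, carrying along a surplus term.
-- To know that the recursion really computes β, one checks that its ab-expansion satisfies the
-- factorisation of the ab-index of B_{n+1} over the elements of a fixed rank; this pins it down,
-- via the binomial flag f-vector of B_{n+1} and inclusion–exclusion, as the flag h-vector.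
-- A cd-polynomial is determined by its ab-expansion, so β is this recursively computed
-- polynomial. For u = v = [], both coefficients of Ψ(B_3) = c² + d are 1.

module Submission where

open import Defs
open import Algebra.Bundles using (AbelianGroup)
open import Data.Bool using (Bool; true; false; _∧_)
open import Data.Bool.Properties using (∧-zeroʳ)
open import Data.Fin.Subset using (Subset; ∣_∣; ⊥; inside; outside; _⊆_)
open import Data.Fin.Subset.Properties using (_⊆?_; p⊆q⇒∣p∣≤∣q∣; ∣p∣≤n; ∣⊥∣≡0)
open import Data.Integer as ℤ using (ℤ; +_; _+_; _-_; -_; _*_; _≤_; +≤+)
open import Data.Integer.Properties as ℤ using (pos-+; +-identityˡ; +-identityʳ)
open import Data.Integer.Tactic.RingSolver using (solve-∀)
open import Algebra.Properties.CommutativeSemigroup ℤ.+-commutativeSemigroup using (interchange)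
open import Algebra.Properties.Group (AbelianGroup.group ℤ.+-0-abelianGroup) using (∙-cancelˡ)
open import Data.List using (List; []; _∷_; _++_; map; filter; length; replicate)
open import Data.List.Properties using (filter-++; length-++; length-map; map-++; map-∘; map-cong; map-cong-local; ++-identityʳ)
open import Data.List.Relation.Unary.All as All using (All)
open import Data.List.Relation.Unary.All.Properties using (all-filter)
open import Data.Nat as ℕ using (ℕ; zero; suc; _∸_; _≟_; z≤n)
open import Data.Nat.Combinatorics using (_C_; nC1≡n; nCn≡1; nCk+nC[k+1]≡[n+1]C[k+1])
open import Data.Nat.ListAction using (sum)
open import Data.Nat.Properties as ℕ using (+-mono-≤; m≤n+m; m+n≤o⇒n≤o; m≤n⇒m≤1+n; m∸n+n≡m; +-∸-assoc; ≤-reflexive; suc-injective)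
import Data.Nat.Tactic.RingSolver as ℕ-Ring
open import Data.Product using (_×_; _,_)
open import Data.Vec using (Vec; []; _∷_; toList)
open import Data.Vec.Properties using (length-toList)
open import Function using (_∘_)
open import Relation.Nullary using (does)
open import Relation.Nullary.Decidable using (_×-dec_; dec-false)
open import Relation.Unary using (Pred; Decidable)
open import Relation.Binary.PropositionalEquality using (_≡_; _≗_; refl; sym; trans; cong; cong₂; subst; subst₂)
open Relation.Binary.PropositionalEquality.≡-Reasoning

module _ {a b p} {A : Set a} {B : Set b} {P : Pred B p} (P? : Decidable P) where

  filter-map : ∀ (f : A → B) xs → filter P? (map f xs) ≡ map f (filter (P? ∘ f) xs)
  filter-map f []       = refl
  filter-map f (x ∷ xs) with does (P? (f x))
  ... | true  = cong (f x ∷_) (filter-map f xs)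
  ... | false = filter-map f xs

module _ {a p q} {A : Set a} {P : Pred A p} {Q : Pred A q} {P? : Decidable P} {Q? : Decidable Q} where

  filter-does-cong : (∀ x → does (P? x) ≡ does (Q? x)) → filter P? ≗ filter Q?
  filter-does-cong eq []       = refl
  filter-does-cong eq (x ∷ xs) with does (P? x) | does (Q? x) | eq x
  ... | true  | true  | refl = cong (x ∷_) (filter-does-cong eq xs)
  ... | false | false | refl = filter-does-cong eq xs

filter-none-does : ∀ {a p} {A : Set a} {P : Pred A p} {P? : Decidable P} →
                   (∀ x → does (P? x) ≡ false) → ∀ xs → filter P? xs ≡ []
filter-none-does           never []       = refl
filter-none-does {P? = P?} never (x ∷ xs) with does (P? x) | never x
... | false | refl = filter-none-does never xs

sum-map-const : ∀ {A : Set} K (xs : List A) → sum (map (λ _ → K) xs) ≡ length xs ℕ.* K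
sum-map-const K []       = refl
sum-map-const K (x ∷ xs) = cong (K ℕ.+_) (sum-map-const K xs)

sumℤ-++ : ∀ xs ys → sumℤ (xs ++ ys) ≡ sumℤ xs + sumℤ ys
sumℤ-++ []       ys = sym (+-identityˡ _)
sumℤ-++ (x ∷ xs) ys = trans (cong (_+_ x) (sumℤ-++ xs ys)) (sym (ℤ.+-assoc x _ _))

sumℤ-map-++ : ∀ {A : Set} (f : A → ℤ) xs ys → sumℤ (map f (xs ++ ys)) ≡ sumℤ (map f xs) + sumℤ (map f ys)
sumℤ-map-++ f xs ys = trans (cong sumℤ (map-++ f xs ys)) (sumℤ-++ (map f xs) (map f ys))

sumℤ-commute : ∀ (φ : ℤ → ℤ) → φ (+ 0) ≡ + 0 → (∀ s t → φ (s + t) ≡ φ s + φ t) →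
               ∀ {A : Set} (f : A → ℤ) xs → sumℤ (map (φ ∘ f) xs) ≡ φ (sumℤ (map f xs))
sumℤ-commute φ φ0 φ+ f []       = sym φ0
sumℤ-commute φ φ0 φ+ f (x ∷ xs) =
  trans (cong (_+_ (φ (f x))) (sumℤ-commute φ φ0 φ+ f xs)) (sym (φ+ (f x) _))

-- The cd-index of the Boolean lattices

cPrefix : (List CD → ℕ) → List CD → ℕ
cPrefix f (c ∷ w) = f w
cPrefix f _       = 0

derivation : (List CD → ℕ) → List CD → ℕ
derivation f []      = 0
derivation f (c ∷ w) = derivation (f ∘ (c ∷_)) w
derivation f (d ∷ w) = f (c ∷ w) ℕ.+ (cPrefix (f ∘ (d ∷_)) w ℕ.+ derivation (f ∘ (d ∷_)) w)

booleanStep : (List CD → ℕ) → List CD → ℕ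
booleanStep f w = cPrefix f w ℕ.+ derivation f w

-- coefficients of Ψ(B_{n+1}); the recursion is the mirror image of Ehrenborg–Readdy's
ΨB : ℕ → List CD → ℕ
ΨB zero    []      = 1
ΨB zero    (_ ∷ _) = 0
ΨB (suc n)         = booleanStep (ΨB n)

-- Replacing cc by d

CC≤D : (List CD → ℕ) → Set
CC≤D f = ∀ u v → f (u ++ c ∷ c ∷ v) ℕ.≤ f (u ++ d ∷ v)

cPrefix-mono : ∀ {f g} → (∀ w → f w ℕ.≤ g w) → ∀ w → cPrefix f w ℕ.≤ cPrefix g w
cPrefix-mono f≤g []      = z≤n
cPrefix-mono f≤g (c ∷ w) = f≤g w
cPrefix-mono f≤g (d ∷ w) = z≤n

derivation-mono : ∀ {f g} → (∀ w → f w ℕ.≤ g w) → ∀ w → derivation f w ℕ.≤ derivation g w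
derivation-mono f≤g []      = z≤n
derivation-mono f≤g (c ∷ w) = derivation-mono (f≤g ∘ (c ∷_)) w
derivation-mono f≤g (d ∷ w) =
  +-mono-≤ (f≤g (c ∷ w)) (+-mono-≤ (cPrefix-mono (f≤g ∘ (d ∷_)) w) (derivation-mono (f≤g ∘ (d ∷_)) w))

-- f (u ++ c ∷ v), or 0 when u ends in d: the surplus that the induction below carries along
slack : List CD → (List CD → ℕ) → List CD → ℕ
slack []          f v = f (c ∷ v)
slack (c ∷ u)     f v = slack u (f ∘ (c ∷_)) v
slack (d ∷ [])    f v = 0
slack (d ∷ x ∷ u) f v = slack (x ∷ u) (f ∘ (d ∷_)) v

slack-interchange : ∀ s {x x′ y y′ g g′} → x ℕ.≤ x′ → y ℕ.≤ y′ → s ℕ.+ g ℕ.≤ g′ →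
                    s ℕ.+ (x ℕ.+ (y ℕ.+ g)) ℕ.≤ x′ ℕ.+ (y′ ℕ.+ g′)
slack-interchange s {x} {_} {y} {_} {g} x≤x′ y≤y′ s+g≤g′ =
  ℕ.≤-trans (≤-reflexive (shuffle s x y g)) (+-mono-≤ x≤x′ (+-mono-≤ y≤y′ s+g≤g′))
  where
  shuffle : ∀ s x y g → s ℕ.+ (x ℕ.+ (y ℕ.+ g)) ≡ x ℕ.+ (y ℕ.+ (s ℕ.+ g))
  shuffle = ℕ-Ring.solve-∀

derivation-cc≤d : ∀ u f v → CC≤D f →
  slack u f v ℕ.+ derivation f (u ++ c ∷ c ∷ v) ℕ.≤ derivation f (u ++ d ∷ v)
derivation-cc≤d []          f v mono =
  +-mono-≤ (ℕ.≤-refl {f (c ∷ v)})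
           (ℕ.≤-trans (derivation-mono (mono []) v) (m≤n+m _ (cPrefix (f ∘ (d ∷_)) v)))
derivation-cc≤d (c ∷ u)     f v mono = derivation-cc≤d u (f ∘ (c ∷_)) v (mono ∘ (c ∷_))
derivation-cc≤d (d ∷ [])    f v mono =
  +-mono-≤ (mono (c ∷ []) v) (derivation-cc≤d [] (f ∘ (d ∷_)) v (mono ∘ (d ∷_)))
derivation-cc≤d (d ∷ c ∷ u) f v mono =
  slack-interchange (slack u (f ∘ (d ∷_) ∘ (c ∷_)) v) (mono (c ∷ c ∷ u) v) (mono (d ∷ u) v)
                    (derivation-cc≤d (c ∷ u) (f ∘ (d ∷_)) v (mono ∘ (d ∷_)))
derivation-cc≤d (d ∷ d ∷ u) f v mono =
  slack-interchange (slack (d ∷ u) (f ∘ (d ∷_)) v) (mono (c ∷ d ∷ u) v) (ℕ.≤-refl {0})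
                    (derivation-cc≤d (d ∷ u) (f ∘ (d ∷_)) v (mono ∘ (d ∷_)))

booleanStep-cc≤d : ∀ f → CC≤D f → CC≤D (booleanStep f)
booleanStep-cc≤d f mono []      v = derivation-cc≤d [] f v mono
booleanStep-cc≤d f mono (c ∷ u) v =
  +-mono-≤ (mono u v) (m+n≤o⇒n≤o (slack u (f ∘ (c ∷_)) v) (derivation-cc≤d (c ∷ u) f v mono))
booleanStep-cc≤d f mono (d ∷ u) v = m+n≤o⇒n≤o (slack (d ∷ u) f v) (derivation-cc≤d (d ∷ u) f v mono)

ΨB-cc≤d : ∀ n → CC≤D (ΨB n)
ΨB-cc≤d zero    []      v = z≤n
ΨB-cc≤d zero    (_ ∷ _) v = z≤n
ΨB-cc≤d (suc n)           = booleanStep-cc≤d (ΨB n) (ΨB-cc≤d n)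

-- ab-expansions

-- multiplication by the coefficient of xy in d = ab + ba
ifDistinct : AB → AB → ℤ → ℤ
ifDistinct a b t = t
ifDistinct b a t = t
ifDistinct a a _ = + 0
ifDistinct b b _ = + 0

ifDistinct-commute : ∀ x y (φ : ℤ → ℤ) {t} → φ (+ 0) ≡ + 0 → ifDistinct x y (φ t) ≡ φ (ifDistinct x y t)
ifDistinct-commute a a φ φ0 = sym φ0
ifDistinct-commute a b φ φ0 = refl
ifDistinct-commute b a φ φ0 = refl
ifDistinct-commute b b φ φ0 = sym φ0

ifDistinct-+ : ∀ x y s t → ifDistinct x y (s + t) ≡ ifDistinct x y s + ifDistinct x y t
ifDistinct-+ a a s t = refl
ifDistinct-+ a b s t = refl
ifDistinct-+ b a s t = refl
ifDistinct-+ b b s t = refl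

ifDistinct-same : ∀ x t → ifDistinct x x t ≡ + 0
ifDistinct-same a t = refl
ifDistinct-same b t = refl

ifDistinct-zero : ∀ x y → ifDistinct x y (+ 0) ≡ + 0
ifDistinct-zero x y = ifDistinct-commute x y (λ _ → + 0) {+ 0} refl

-- coefficient of an ab-word in the ab-expansion (c = a + b, d = ab + ba) of a cd-polynomial
expand : (List CD → ℤ) → List AB → ℤ
expand f []          = f []
expand f (_ ∷ [])    = f (c ∷ [])
expand f (x ∷ y ∷ w) = expand (f ∘ (c ∷_)) (y ∷ w) + ifDistinct x y (expand (f ∘ (d ∷_)) w)

expand-cong : ∀ {f g} → f ≗ g → expand f ≗ expand g
expand-cong f≗g []          = f≗g []
expand-cong f≗g (_ ∷ [])    = f≗g (c ∷ [])
expand-cong f≗g (x ∷ y ∷ w) =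
  cong₂ _+_ (expand-cong (f≗g ∘ (c ∷_)) (y ∷ w)) (cong (ifDistinct x y) (expand-cong (f≗g ∘ (d ∷_)) w))

expand-+ : ∀ f g w → expand (λ v → f v + g v) w ≡ expand f w + expand g w
expand-+ f g []          = refl
expand-+ f g (_ ∷ [])    = refl
expand-+ f g (x ∷ y ∷ w) = begin
  expand (λ v → f (c ∷ v) + g (c ∷ v)) (y ∷ w) + ifDistinct x y (expand (λ v → f (d ∷ v) + g (d ∷ v)) w)
    ≡⟨ cong₂ _+_ (expand-+ _ _ (y ∷ w)) (trans (cong (ifDistinct x y) (expand-+ _ _ w)) (ifDistinct-+ x y _ _)) ⟩
  (fc + gc) + (fd + gd) ≡⟨ interchange fc gc fd gd ⟩
  (fc + fd) + (gc + gd) ∎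
  where
  fc gc fd gd : ℤ
  fc = expand (f ∘ (c ∷_)) (y ∷ w)
  gc = expand (g ∘ (c ∷_)) (y ∷ w)
  fd = ifDistinct x y (expand (f ∘ (d ∷_)) w)
  gd = ifDistinct x y (expand (g ∘ (d ∷_)) w)

expand-pos-+ : ∀ f g w → expand (λ v → + (f v ℕ.+ g v)) w ≡ expand (+_ ∘ f) w + expand (+_ ∘ g) w
expand-pos-+ f g w = trans (expand-cong (λ v → pos-+ (f v) (g v)) w) (expand-+ (+_ ∘ f) (+_ ∘ g) w)

expand-zero : ∀ w → expand (λ _ → + 0) w ≡ + 0
expand-zero []          = refl
expand-zero (_ ∷ [])    = refl
expand-zero (x ∷ y ∷ w) =
  cong₂ _+_ (expand-zero (y ∷ w)) (trans (cong (ifDistinct x y) (expand-zero w)) (ifDistinct-zero x y))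

-- the derivation a ↦ ab, b ↦ ba, which restricts to G (c ↦ d, d ↦ dc) on cd-polynomials
abDerivation : (List AB → ℤ) → List AB → ℤ
abDerivation h []          = + 0
abDerivation h (_ ∷ [])    = + 0
abDerivation h (x ∷ y ∷ w) = ifDistinct x y (h (x ∷ w)) + abDerivation (h ∘ (x ∷_)) (y ∷ w)

abDerivation-local : ∀ {h h′} x w → (∀ v → length v ≡ length w → h v ≡ h′ v) →
                     abDerivation h (x ∷ w) ≡ abDerivation h′ (x ∷ w)
abDerivation-local x []      h≡h′ = refl
abDerivation-local x (y ∷ w) h≡h′ =
  cong₂ _+_ (cong (ifDistinct x y) (h≡h′ (x ∷ w) refl))
            (abDerivation-local y w (λ v eq → h≡h′ (x ∷ v) (cong suc eq)))

abDerivation-cong : ∀ {h h′} → h ≗ h′ → abDerivation h ≗ abDerivation h′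
abDerivation-cong h≗h′ []      = refl
abDerivation-cong h≗h′ (x ∷ w) = abDerivation-local x w (λ v _ → h≗h′ v)

abDerivation-+ : ∀ h h′ w → abDerivation (λ v → h v + h′ v) w ≡ abDerivation h w + abDerivation h′ w
abDerivation-+ h h′ []          = refl
abDerivation-+ h h′ (_ ∷ [])    = refl
abDerivation-+ h h′ (x ∷ y ∷ w) = begin
  ifDistinct x y (h (x ∷ w) + h′ (x ∷ w)) + abDerivation (λ v → h (x ∷ v) + h′ (x ∷ v)) (y ∷ w)
    ≡⟨ cong₂ _+_ (ifDistinct-+ x y _ _) (abDerivation-+ (h ∘ (x ∷_)) (h′ ∘ (x ∷_)) (y ∷ w)) ⟩
  (p + p′) + (q + q′) ≡⟨ interchange p p′ q q′ ⟩
  (p + q) + (p′ + q′) ∎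
  where
  p p′ q q′ : ℤ
  p  = ifDistinct x y (h (x ∷ w))
  p′ = ifDistinct x y (h′ (x ∷ w))
  q  = abDerivation (h ∘ (x ∷_)) (y ∷ w)
  q′ = abDerivation (h′ ∘ (x ∷_)) (y ∷ w)

abDerivation-commute : ∀ (φ : ℤ → ℤ) → φ (+ 0) ≡ + 0 → (∀ s t → φ (s + t) ≡ φ s + φ t) →
                       ∀ h w → abDerivation (φ ∘ h) w ≡ φ (abDerivation h w)
abDerivation-commute φ φ0 φ+ h []          = sym φ0
abDerivation-commute φ φ0 φ+ h (_ ∷ [])    = sym φ0
abDerivation-commute φ φ0 φ+ h (x ∷ y ∷ w) = begin
  ifDistinct x y (φ (h (x ∷ w))) + abDerivation (φ ∘ h ∘ (x ∷_)) (y ∷ w)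
    ≡⟨ cong₂ _+_ (ifDistinct-commute x y φ φ0) (abDerivation-commute φ φ0 φ+ (h ∘ (x ∷_)) (y ∷ w)) ⟩
  φ (ifDistinct x y (h (x ∷ w))) + φ (abDerivation (h ∘ (x ∷_)) (y ∷ w))
    ≡⟨ sym (φ+ _ _) ⟩
  φ (abDerivation h (x ∷ y ∷ w)) ∎

abDerivation-* : ∀ k h w → abDerivation (λ v → k * h v) w ≡ k * abDerivation h w
abDerivation-* k = abDerivation-commute (k *_) (ℤ.*-zeroʳ k) (ℤ.*-distribˡ-+ k)

dPart : (List CD → ℤ) → AB → List AB → ℤ
dPart f x []      = + 0
dPart f x (y ∷ w) = ifDistinct x y (expand (f ∘ (d ∷_)) w)

expand-∷ : ∀ f x w → expand f (x ∷ w) ≡ expand (f ∘ (c ∷_)) w + dPart f x w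
expand-∷ f x []      = sym (+-identityʳ _)
expand-∷ f x (_ ∷ _) = refl

expand-cPrefix : ∀ g x w → expand (+_ ∘ cPrefix g) (x ∷ w) ≡ expand (+_ ∘ g) w
expand-cPrefix g x []      = refl
expand-cPrefix g x (y ∷ w) = begin
  expand (+_ ∘ g) (y ∷ w) + ifDistinct x y (expand (λ _ → + 0) w)
    ≡⟨ cong (λ t → expand (+_ ∘ g) (y ∷ w) + ifDistinct x y t) (expand-zero w) ⟩
  expand (+_ ∘ g) (y ∷ w) + ifDistinct x y (+ 0)
    ≡⟨ cong (_+_ (expand (+_ ∘ g) (y ∷ w))) (ifDistinct-zero x y) ⟩
  expand (+_ ∘ g) (y ∷ w) + + 0
    ≡⟨ +-identityʳ _ ⟩
  expand (+_ ∘ g) (y ∷ w) ∎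

expand-derivation-dPart : ∀ f x y w →
  ifDistinct x y (expand (+_ ∘ cPrefix (f ∘ (d ∷_))) w + abDerivation (expand (+_ ∘ f ∘ (d ∷_))) w)
  ≡ ifDistinct x y (dPart (+_ ∘ f) x w) + abDerivation (dPart (+_ ∘ f) x) (y ∷ w)
expand-derivation-dPart f x y []      = sym (+-identityʳ _)
expand-derivation-dPart f x y (t ∷ w) = begin
  ifDistinct x y (expand (+_ ∘ cPrefix (f ∘ (d ∷_))) (t ∷ w) + abDerivation E (t ∷ w))
    ≡⟨ cong (λ s → ifDistinct x y (s + abDerivation E (t ∷ w))) (expand-cPrefix (f ∘ (d ∷_)) t w) ⟩
  ifDistinct x y (E w + abDerivation E (t ∷ w))
    ≡⟨ shift x y t (E w) (abDerivation E (t ∷ w)) ⟩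
  ifDistinct x y (ifDistinct x t (E w)) + (ifDistinct y t (ifDistinct x y (E w)) + ifDistinct x y (abDerivation E (t ∷ w)))
    ≡⟨ cong (λ s → ifDistinct x y (ifDistinct x t (E w)) + (ifDistinct y t (ifDistinct x y (E w)) + s))
            (sym (abDerivation-commute (ifDistinct x y) (ifDistinct-zero x y) (ifDistinct-+ x y) E (t ∷ w))) ⟩
  ifDistinct x y (dPart (+_ ∘ f) x (t ∷ w)) + abDerivation (dPart (+_ ∘ f) x) (y ∷ t ∷ w) ∎
  where
  E : List AB → ℤ
  E = expand (+_ ∘ f ∘ (d ∷_))
  shift : ∀ x y t e g → ifDistinct x y (e + g)
                      ≡ ifDistinct x y (ifDistinct x t e) + (ifDistinct y t (ifDistinct x y e) + ifDistinct x y g)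
  shift a a a e g = refl
  shift a a b e g = refl
  shift a b a e g = sym (+-identityˡ _)
  shift a b b e g = cong (_+_ e) (sym (+-identityˡ g))
  shift b a a e g = cong (_+_ e) (sym (+-identityˡ g))
  shift b a b e g = sym (+-identityˡ _)
  shift b b a e g = refl
  shift b b b e g = refl

expand-derivation : ∀ f w → expand (+_ ∘ derivation f) w ≡ abDerivation (expand (+_ ∘ f)) w
expand-derivation f []          = refl
expand-derivation f (_ ∷ [])    = refl
expand-derivation f (x ∷ y ∷ w) = begin
  expand (+_ ∘ derivation (f ∘ (c ∷_))) (y ∷ w) + ifDistinct x y (expand (+_ ∘ derivation f ∘ (d ∷_)) w)
    ≡⟨ cong₂ _+_ (expand-derivation (f ∘ (c ∷_)) (y ∷ w)) (cong (ifDistinct x y) d-terms) ⟩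
  Gc + ifDistinct x y (A + (B + C))
    ≡⟨ cong (_+_ Gc) (trans (ifDistinct-+ x y A (B + C)) (cong (_+_ (ifDistinct x y A)) (expand-derivation-dPart f x y w))) ⟩
  Gc + (ifDistinct x y A + (ifDistinct x y (D w) + abDerivation D (y ∷ w)))
    ≡⟨ regroup Gc (ifDistinct x y A) (ifDistinct x y (D w)) (abDerivation D (y ∷ w)) ⟩
  (ifDistinct x y A + ifDistinct x y (D w)) + (Gc + abDerivation D (y ∷ w))
    ≡⟨ cong₂ _+_ (sym (trans (cong (ifDistinct x y) (expand-∷ (+_ ∘ f) x w)) (ifDistinct-+ x y _ _)))
                 (sym (trans (abDerivation-cong (expand-∷ (+_ ∘ f) x) (y ∷ w)) (abDerivation-+ _ _ (y ∷ w)))) ⟩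
  ifDistinct x y (expand (+_ ∘ f) (x ∷ w)) + abDerivation (expand (+_ ∘ f) ∘ (x ∷_)) (y ∷ w) ∎
  where
  Gc A B C : ℤ
  Gc = abDerivation (expand (+_ ∘ f ∘ (c ∷_))) (y ∷ w)
  A  = expand (+_ ∘ f ∘ (c ∷_)) w
  B  = expand (+_ ∘ cPrefix (f ∘ (d ∷_))) w
  C  = abDerivation (expand (+_ ∘ f ∘ (d ∷_))) w
  D : List AB → ℤ
  D  = dPart (+_ ∘ f) x
  d-terms : expand (+_ ∘ derivation f ∘ (d ∷_)) w ≡ A + (B + C)
  d-terms = begin
    expand (+_ ∘ derivation f ∘ (d ∷_)) w
      ≡⟨ expand-pos-+ (f ∘ (c ∷_)) _ w ⟩
    A + expand (λ v → + (cPrefix (f ∘ (d ∷_)) v ℕ.+ derivation (f ∘ (d ∷_)) v)) w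
      ≡⟨ cong (_+_ A) (trans (expand-pos-+ _ _ w) (cong (_+_ B) (expand-derivation (f ∘ (d ∷_)) w))) ⟩
    A + (B + C) ∎
  regroup : ∀ p q r s → p + (q + (r + s)) ≡ (q + r) + (p + s)
  regroup = solve-∀

expand-booleanStep : ∀ f x w →
  expand (+_ ∘ booleanStep f) (x ∷ w) ≡ expand (+_ ∘ f) w + abDerivation (expand (+_ ∘ f)) (x ∷ w)
expand-booleanStep f x w =
  trans (expand-pos-+ (cPrefix f) (derivation f) (x ∷ w))
        (cong₂ _+_ (expand-cPrefix f x w) (expand-derivation f (x ∷ w)))

-- The ab-index of Ψ(B) over the elements of a fixed rank

abΨB : ℕ → List AB → ℤ
abΨB n = expand (+_ ∘ ΨB n)

abΨB-suc : ∀ n x w → abΨB (suc n) (x ∷ w) ≡ abΨB n w + abDerivation (abΨB n) (x ∷ w)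
abΨB-suc n = expand-booleanStep (ΨB n)

a^_ : ℕ → List AB
a^ j = replicate j a

a^-++-a∷ : ∀ j w → a^ j ++ a ∷ w ≡ a ∷ (a^ j ++ w)
a^-++-a∷ zero    w = refl
a^-++-a∷ (suc j) w = cong (a ∷_) (a^-++-a∷ j w)

abDerivation-a^ : ∀ h n → abDerivation h (a^ suc n) ≡ + 0
abDerivation-a^ h zero    = refl
abDerivation-a^ h (suc n) = trans (+-identityˡ _) (abDerivation-a^ (h ∘ (a ∷_)) n)

abDerivation-a∷a^ : ∀ h j w → abDerivation h (a ∷ (a^ j ++ w)) ≡ abDerivation (h ∘ (a^ j ++_)) (a ∷ w)
abDerivation-a∷a^ h zero    w = refl
abDerivation-a∷a^ h (suc j) w = trans (+-identityˡ _) (abDerivation-a∷a^ (h ∘ (a ∷_)) j w)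

abΨB-a^ : ∀ n → abΨB n (a^ n) ≡ + 1
abΨB-a^ zero    = refl
abΨB-a^ (suc n) = begin
  abΨB (suc n) (a^ suc n)                          ≡⟨ abΨB-suc n a (a^ n) ⟩
  abΨB n (a^ n) + abDerivation (abΨB n) (a^ suc n) ≡⟨ cong₂ _+_ (abΨB-a^ n) (abDerivation-a^ (abΨB n) n) ⟩
  + 1                                              ∎

sumFirst : (List AB → ℤ) → List AB → ℤ
sumFirst h w = h (a ∷ w) + h (b ∷ w)

ifDistinct-sum : ∀ z (F : AB → ℤ) → ifDistinct a z (F a) + ifDistinct b z (F b) + F z ≡ F a + F b
ifDistinct-sum a F = trans (cong (_+ F a) (+-identityˡ (F b))) (ℤ.+-comm (F b) (F a))
ifDistinct-sum b F = cong (_+ F b) (+-identityʳ (F a))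

abDerivation-sumFirst : ∀ h z w →
  h (z ∷ w) + sumFirst (abDerivation h) (z ∷ w) ≡ sumFirst h w + abDerivation (sumFirst h) (z ∷ w)
abDerivation-sumFirst h z w = begin
  F z + ((ifDistinct a z (F a) + Ga) + (ifDistinct b z (F b) + Gb))
    ≡⟨ regroup (F z) (ifDistinct a z (F a)) (ifDistinct b z (F b)) Ga Gb ⟩
  (ifDistinct a z (F a) + ifDistinct b z (F b) + F z) + (Ga + Gb)
    ≡⟨ cong₂ _+_ (ifDistinct-sum z F) (sym (abDerivation-+ (h ∘ (a ∷_)) (h ∘ (b ∷_)) (z ∷ w))) ⟩
  sumFirst h w + abDerivation (sumFirst h) (z ∷ w) ∎
  where
  F : AB → ℤ
  F x = h (x ∷ w)
  Ga Gb : ℤ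
  Ga = abDerivation (h ∘ (a ∷_)) (z ∷ w)
  Gb = abDerivation (h ∘ (b ∷_)) (z ∷ w)
  regroup : ∀ p q r s t → p + ((q + s) + (r + t)) ≡ (q + r + p) + (s + t)
  regroup = solve-∀

sumFirst-abDerivation-scale : ∀ g K z w → (∀ v → length v ≡ length w → sumFirst g v ≡ K * abΨB (length w) v) →
  g (z ∷ w) + sumFirst (abDerivation g) (z ∷ w) ≡ K * abΨB (suc (length w)) (z ∷ w)
sumFirst-abDerivation-scale g K z w hyp = begin
  g (z ∷ w) + sumFirst (abDerivation g) (z ∷ w)
    ≡⟨ abDerivation-sumFirst g z w ⟩
  sumFirst g w + abDerivation (sumFirst g) (z ∷ w)
    ≡⟨ cong₂ _+_ (hyp w refl) (abDerivation-local z w hyp) ⟩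
  K * H w + abDerivation (λ v → K * H v) (z ∷ w)
    ≡⟨ cong (_+_ (K * H w)) (abDerivation-* K H (z ∷ w)) ⟩
  K * H w + K * abDerivation H (z ∷ w)
    ≡⟨ sym (ℤ.*-distribˡ-+ K _ _) ⟩
  K * (H w + abDerivation H (z ∷ w))
    ≡⟨ cong (K *_) (sym (abΨB-suc (length w) z w)) ⟩
  K * abΨB (suc (length w)) (z ∷ w) ∎
  where
  H : List AB → ℤ
  H = abΨB (length w)

-- Summing the ab-index of B_{n+1} over the letter in position j+1, all earlier letters
-- being a, counts the C(n+1, j+1) elements of rank j+1 times the ab-index of the upper
-- interval above each, a Boolean lattice B_{|w|+1}.
Factorises : ℕ → ℕ → List AB → Set
Factorises n j w = sumFirst (abΨB n ∘ (a^ j ++_)) w ≡ + (suc n C suc j) * abΨB (length w) w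

pascal-* : ∀ n k X → + (suc (suc n) C suc (suc k)) * X ≡ + (suc n C suc k) * X + + (suc n C suc (suc k)) * X
pascal-* n k X = begin
  + (suc (suc n) C suc (suc k)) * X
    ≡⟨ cong (λ m → + m * X) (sym (nCk+nC[k+1]≡[n+1]C[k+1] (suc n) (suc k))) ⟩
  + (suc n C suc k ℕ.+ suc n C suc (suc k)) * X
    ≡⟨ cong (_* X) (pos-+ (suc n C suc k) (suc n C suc (suc k))) ⟩
  (+ (suc n C suc k) + + (suc n C suc (suc k))) * X
    ≡⟨ ℤ.*-distribʳ-+ X (+ (suc n C suc k)) (+ (suc n C suc (suc k))) ⟩
  + (suc n C suc k) * X + + (suc n C suc (suc k)) * X ∎

factorises-head : ∀ y w → (∀ v → length v ≡ length w → Factorises (suc (length w)) 0 v) →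
                  Factorises (suc (suc (length w))) 0 (y ∷ w)
factorises-head y w ih = begin
  abΨB (suc N) (a ∷ y ∷ w) + abΨB (suc N) (b ∷ y ∷ w)
    ≡⟨ cong₂ _+_ (abΨB-suc N a (y ∷ w)) (abΨB-suc N b (y ∷ w)) ⟩
  (h + abDerivation (abΨB N) (a ∷ y ∷ w)) + (h + abDerivation (abΨB N) (b ∷ y ∷ w))
    ≡⟨ regroup h _ _ ⟩
  h + (h + sumFirst (abDerivation (abΨB N)) (y ∷ w))
    ≡⟨ cong (_+_ h) (sumFirst-abDerivation-scale (abΨB N) K y w ih′) ⟩
  h + K * h
    ≡⟨ cong (λ m → h + + m * h) (nC1≡n (suc N)) ⟩
  h + + suc N * h
    ≡⟨ absorb h (+ suc N) ⟩
  + suc (suc N) * h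
    ≡⟨ cong (λ m → + m * h) (sym (nC1≡n (suc (suc N)))) ⟩
  + (suc (suc N) C 1) * h ∎
  where
  N : ℕ
  N = suc (length w)
  h : ℤ
  h = abΨB N (y ∷ w)
  K : ℤ
  K = + (suc N C 1)
  ih′ : ∀ v → length v ≡ length w → sumFirst (abΨB N) v ≡ K * abΨB (length w) v
  ih′ v eq = trans (ih v eq) (cong (λ m → K * abΨB m v) eq)
  regroup : ∀ h p q → (h + p) + (h + q) ≡ h + (h + (p + q))
  regroup = solve-∀
  absorb : ∀ h k → h + k * h ≡ (+ 1 + k) * h
  absorb = solve-∀

sumFirst-a∷ : ∀ n j w →
  sumFirst (abΨB (suc n) ∘ (a^ suc j ++_)) w
  ≡ sumFirst (abΨB n ∘ (a^ j ++_)) w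
    + (abΨB n (a^ j ++ a ∷ w) + sumFirst (abDerivation (λ v → abΨB n (a^ j ++ a ∷ v))) w)
sumFirst-a∷ n j w = begin
  abΨB (suc n) (a ∷ (a^ j ++ a ∷ w)) + abΨB (suc n) (a ∷ (a^ j ++ b ∷ w))
    ≡⟨ cong₂ _+_ (step a) (step b) ⟩
  (P a + (+ 0 + abDerivation k (a ∷ w))) + (P b + (k w + abDerivation k (b ∷ w)))
    ≡⟨ regroup (P a) (P b) (k w) (abDerivation k (a ∷ w)) (abDerivation k (b ∷ w)) ⟩
  (P a + P b) + (k w + (abDerivation k (a ∷ w) + abDerivation k (b ∷ w))) ∎
  where
  P : AB → ℤ
  P x = abΨB n (a^ j ++ x ∷ w)
  k : List AB → ℤ
  k v = abΨB n (a^ j ++ a ∷ v)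
  step : ∀ x → abΨB (suc n) (a ∷ (a^ j ++ x ∷ w)) ≡ P x + abDerivation (abΨB n ∘ (a^ j ++_)) (a ∷ x ∷ w)
  step x = trans (abΨB-suc n a (a^ j ++ x ∷ w)) (cong (_+_ (P x)) (abDerivation-a∷a^ (abΨB n) j (x ∷ w)))
  regroup : ∀ p q r s t → (p + (+ 0 + s)) + (q + (r + t)) ≡ (p + q) + (r + (s + t))
  regroup = solve-∀

abΨB-factorises : ∀ n j w → n ≡ j ℕ.+ suc (length w) → Factorises n j w
abΨB-factorises zero          zero    w       ()
abΨB-factorises zero          (suc j) w       ()
abΨB-factorises (suc n)       zero    []      refl = refl
abΨB-factorises (suc zero)    zero    (y ∷ w) ()
abΨB-factorises (suc (suc m)) zero    (y ∷ w) refl =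
  factorises-head y w (λ v eq → abΨB-factorises (suc m) 0 v (cong suc (sym eq)))
abΨB-factorises (suc n)       (suc j) []      eq = begin
  sumFirst (abΨB (suc n) ∘ (a^ suc j ++_)) []
    ≡⟨ sumFirst-a∷ n j [] ⟩
  sumFirst (abΨB n ∘ (a^ j ++_)) [] + (abΨB n (a^ j ++ a ∷ []) + (+ 0 + + 0))
    ≡⟨ cong₂ (λ s t → s + (t + + 0)) (abΨB-factorises n j [] n≡) last≡1 ⟩
  + (suc n C suc j) * + 1 + + 1 * + 1
    ≡⟨ cong (λ m → + (suc n C suc j) * + 1 + + m * + 1) (sym C≡1) ⟩
  + (suc n C suc j) * + 1 + + (suc n C suc (suc j)) * + 1
    ≡⟨ sym (pascal-* n j (+ 1)) ⟩
  + (suc (suc n) C suc (suc j)) * + 1 ∎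
  where
  n≡ : n ≡ j ℕ.+ 1
  n≡ = suc-injective eq
  n≡suc-j : n ≡ suc j
  n≡suc-j = trans n≡ (ℕ.+-comm j 1)
  last≡1 : abΨB n (a^ j ++ a ∷ []) ≡ + 1
  last≡1 = begin
    abΨB n (a^ j ++ a ∷ [])  ≡⟨ cong (abΨB n) (trans (a^-++-a∷ j []) (cong (a ∷_) (++-identityʳ (a^ j)))) ⟩
    abΨB n (a^ suc j)        ≡⟨ cong (λ m → abΨB m (a^ suc j)) n≡suc-j ⟩
    abΨB (suc j) (a^ suc j)  ≡⟨ abΨB-a^ (suc j) ⟩
    + 1                      ∎
  C≡1 : suc n C suc (suc j) ≡ 1
  C≡1 = trans (cong (λ m → suc m C suc (suc j)) n≡suc-j) (nCn≡1 (suc (suc j)))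
abΨB-factorises (suc n)       (suc j) (z ∷ w) eq = begin
  sumFirst (abΨB (suc n) ∘ (a^ suc j ++_)) (z ∷ w)
    ≡⟨ sumFirst-a∷ n j (z ∷ w) ⟩
  sumFirst (abΨB n ∘ (a^ j ++_)) (z ∷ w) + (k (z ∷ w) + sumFirst (abDerivation k) (z ∷ w))
    ≡⟨ cong₂ _+_ (abΨB-factorises n j (z ∷ w) n≡) (sumFirst-abDerivation-scale k (+ C₂) z w ih) ⟩
  + C₁ * abΨB (suc (length w)) (z ∷ w) + + C₂ * abΨB (suc (length w)) (z ∷ w)
    ≡⟨ sym (pascal-* n j _) ⟩
  + (suc (suc n) C suc (suc j)) * abΨB (suc (length w)) (z ∷ w) ∎
  where
  C₁ C₂ : ℕ
  C₁ = suc n C suc j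
  C₂ = suc n C suc (suc j)
  n≡ : n ≡ j ℕ.+ suc (length (z ∷ w))
  n≡ = suc-injective eq
  k : List AB → ℤ
  k v = abΨB n (a^ j ++ a ∷ v)
  ih : ∀ v → length v ≡ length w → sumFirst k v ≡ + C₂ * abΨB (length w) v
  ih v eq′ = begin
    sumFirst k v
      ≡⟨ cong₂ _+_ (cong (abΨB n) (a^-++-a∷ j (a ∷ v))) (cong (abΨB n) (a^-++-a∷ j (b ∷ v))) ⟩
    sumFirst (abΨB n ∘ (a^ suc j ++_)) v
      ≡⟨ abΨB-factorises n (suc j) v (trans n≡ (trans (ℕ.+-suc j _) (cong (λ m → suc j ℕ.+ suc m) (sym eq′)))) ⟩
    + C₂ * abΨB (length v) v
      ≡⟨ cong (λ m → + C₂ * abΨB m v) eq′ ⟩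
    + C₂ * abΨB (length w) v ∎

-- Flag vectors of the Boolean lattices

filter-allSubsets : ∀ m {p} {P : Pred (Subset (suc m)) p} (P? : Decidable P) →
  filter P? (allSubsets (suc m))
  ≡ map (outside ∷_) (filter (P? ∘ (outside ∷_)) (allSubsets m))
    ++ map (inside ∷_) (filter (P? ∘ (inside ∷_)) (allSubsets m))
filter-allSubsets m P? = trans (filter-++ P? (map (outside ∷_) S) (map (inside ∷_) S))
                               (cong₂ _++_ (filter-map P? (outside ∷_) S) (filter-map P? (inside ∷_) S))
  where
  S : List (Subset m)
  S = allSubsets m

length-filter-allSubsets : ∀ m {p} {P : Pred (Subset (suc m)) p} (P? : Decidable P) →
  length (filter P? (allSubsets (suc m)))
  ≡ length (filter (P? ∘ (outside ∷_)) (allSubsets m)) ℕ.+ length (filter (P? ∘ (inside ∷_)) (allSubsets m))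
length-filter-allSubsets m P? = begin
  length (filter P? (allSubsets (suc m)))
    ≡⟨ cong length (filter-allSubsets m P?) ⟩
  length (map (outside ∷_) Sₒ ++ map (inside ∷_) Sᵢ)
    ≡⟨ length-++ (map (outside ∷_) Sₒ) ⟩
  length (map (outside ∷_) Sₒ) ℕ.+ length (map (inside ∷_) Sᵢ)
    ≡⟨ cong₂ ℕ._+_ (length-map (outside ∷_) Sₒ) (length-map (inside ∷_) Sᵢ) ⟩
  length Sₒ ℕ.+ length Sᵢ ∎
  where
  Sₒ Sᵢ : List (Subset m)
  Sₒ = filter (P? ∘ (outside ∷_)) (allSubsets m)
  Sᵢ = filter (P? ∘ (inside ∷_)) (allSubsets m)

supersets : (m : ℕ) → Subset m → ℕ → List (Subset m)
supersets m x s = filter (λ y → (∣ y ∣ ≟ s) ×-dec (x ⊆? y)) (allSubsets m)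

length-supersets : ∀ m (x : Subset m) t → length (supersets m x (t ℕ.+ ∣ x ∣)) ≡ (m ∸ ∣ x ∣) C t
length-supersets zero    []            zero    = refl
length-supersets zero    []            (suc t) = refl
length-supersets (suc m) (outside ∷ x) zero    = begin
  length (supersets (suc m) (outside ∷ x) ∣ x ∣)
    ≡⟨ trans (length-filter-allSubsets m _)
             (cong₂ ℕ._+_ (cong length (filter-does-cong (λ _ → refl) (allSubsets m)))
                          (cong length (filter-none-does smaller (allSubsets m)))) ⟩
  length (supersets m x ∣ x ∣) ℕ.+ 0
    ≡⟨ cong (ℕ._+ 0) (length-supersets m x zero) ⟩
  1 ∎
  where
  smaller : ∀ y → does ((suc ∣ y ∣ ≟ ∣ x ∣) ×-dec (x ⊆? y)) ≡ false
  smaller y = dec-false ((suc ∣ y ∣ ≟ ∣ x ∣) ×-dec (x ⊆? y)) λ (|y|+1≡|x| , x⊆y) →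
    ℕ.n≮n ∣ y ∣ (subst (ℕ._≤ ∣ y ∣) (sym |y|+1≡|x|) (p⊆q⇒∣p∣≤∣q∣ x⊆y))
length-supersets (suc m) (outside ∷ x) (suc t) = begin
  length (supersets (suc m) (outside ∷ x) (suc t ℕ.+ ∣ x ∣))
    ≡⟨ trans (length-filter-allSubsets m _)
             (cong₂ ℕ._+_ (cong length (filter-does-cong (λ _ → refl) (allSubsets m)))
                          (cong length (filter-does-cong (λ _ → refl) (allSubsets m)))) ⟩
  length (supersets m x (suc t ℕ.+ ∣ x ∣)) ℕ.+ length (supersets m x (t ℕ.+ ∣ x ∣))
    ≡⟨ cong₂ ℕ._+_ (length-supersets m x (suc t)) (length-supersets m x t) ⟩
  (m ∸ ∣ x ∣) C suc t ℕ.+ (m ∸ ∣ x ∣) C t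
    ≡⟨ trans (ℕ.+-comm ((m ∸ ∣ x ∣) C suc t) ((m ∸ ∣ x ∣) C t)) (nCk+nC[k+1]≡[n+1]C[k+1] (m ∸ ∣ x ∣) t) ⟩
  suc (m ∸ ∣ x ∣) C suc t
    ≡⟨ cong (_C suc t) (sym (+-∸-assoc 1 (∣p∣≤n x))) ⟩
  (suc m ∸ ∣ x ∣) C suc t ∎
length-supersets (suc m) (inside ∷ x)  t       = begin
  length (supersets (suc m) (inside ∷ x) (t ℕ.+ suc ∣ x ∣))
    ≡⟨ trans (length-filter-allSubsets m _)
             (cong₂ ℕ._+_ (cong length (filter-none-does (λ y → ∧-zeroʳ _) (allSubsets m)))
                          (cong length (filter-does-cong shift (allSubsets m)))) ⟩
  length (supersets m x (t ℕ.+ ∣ x ∣))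
    ≡⟨ length-supersets m x t ⟩
  (m ∸ ∣ x ∣) C t ∎
  where
  shift : ∀ y → does ((suc ∣ y ∣ ≟ t ℕ.+ suc ∣ x ∣) ×-dec (x ⊆? y)) ≡ does ((∣ y ∣ ≟ t ℕ.+ ∣ x ∣) ×-dec (x ⊆? y))
  shift y = cong (λ s → does (suc ∣ y ∣ ≟ s) ∧ does (x ⊆? y)) (ℕ.+-suc t ∣ x ∣)

-- chains in B_m above an element of rank r, with ranks read off T from rank k + 1 on
chainCount : ∀ {p} → ℕ → ℕ → ℕ → Vec Bool p → ℕ
chainCount m r k []          = 1
chainCount m r k (false ∷ T) = chainCount m r (suc k) T
chainCount m r k (true  ∷ T) = ((m ∸ r) C (suc k ∸ r)) ℕ.* chainCount m (suc k) (suc k) T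

chainsAbove-rankList : ∀ m (x : Subset m) k {p} (T : Vec Bool p) → ∣ x ∣ ℕ.≤ k →
                       chainsAbove m x (rankList k T) ≡ chainCount m ∣ x ∣ k T
chainsAbove-rankList m x k []          _   = refl
chainsAbove-rankList m x k (false ∷ T) |x|≤k = chainsAbove-rankList m x (suc k) T (m≤n⇒m≤1+n |x|≤k)
chainsAbove-rankList m x k (true  ∷ T) |x|≤k = begin
  sum (map (λ y → chainsAbove m y (rankList (suc k) T)) (supersets m x (suc k)))
    ≡⟨ cong sum (map-cong-local (All.map sameCount (all-filter _ (allSubsets m)))) ⟩
  sum (map (λ _ → K) (supersets m x (suc k)))
    ≡⟨ sum-map-const K (supersets m x (suc k)) ⟩
  length (supersets m x (suc k)) ℕ.* K
    ≡⟨ cong (λ s → length (supersets m x s) ℕ.* K) (sym (m∸n+n≡m (m≤n⇒m≤1+n |x|≤k))) ⟩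
  length (supersets m x ((suc k ∸ ∣ x ∣) ℕ.+ ∣ x ∣)) ℕ.* K
    ≡⟨ cong (ℕ._* K) (length-supersets m x (suc k ∸ ∣ x ∣)) ⟩
  ((m ∸ ∣ x ∣) C (suc k ∸ ∣ x ∣)) ℕ.* K ∎
  where
  K : ℕ
  K = chainCount m (suc k) (suc k) T
  sameCount : ∀ {y} → ∣ y ∣ ≡ suc k × x ⊆ y → chainsAbove m y (rankList (suc k) T) ≡ K
  sameCount (|y|≡ , _) = trans (chainsAbove-rankList m _ (suc k) T (≤-reflexive |y|≡))
                               (cong (λ r → chainCount m r (suc k) T) |y|≡)

flagF-chainCount : ∀ n (T : Vec Bool n) → flagF n T ≡ chainCount (suc n) 0 0 T
flagF-chainCount n T = trans (chainsAbove-rankList (suc n) ⊥ 0 T (≤-reflexive (∣⊥∣≡0 (suc n))))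
                             (cong (λ r → chainCount (suc n) r 0 T) (∣⊥∣≡0 (suc n)))

subsetsOf-outside : ∀ {n} (S : Vec Bool n) → subsetsOf (false ∷ S) ≡ map (outside ∷_) (subsetsOf S)
subsetsOf-outside {n} S = begin
  filter (_⊆? (false ∷ S)) (allSubsets (suc n))
    ≡⟨ filter-allSubsets n (_⊆? (false ∷ S)) ⟩
  map (outside ∷_) (filter _ (allSubsets n)) ++ map (inside ∷_) (filter _ (allSubsets n))
    ≡⟨ cong₂ (λ xs ys → map (outside ∷_) xs ++ map (inside ∷_) ys)
             (filter-does-cong (λ _ → refl) (allSubsets n)) (filter-none-does (λ _ → refl) (allSubsets n)) ⟩
  map (outside ∷_) (subsetsOf S) ++ []
    ≡⟨ ++-identityʳ _ ⟩
  map (outside ∷_) (subsetsOf S) ∎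

subsetsOf-inside : ∀ {n} (S : Vec Bool n) →
  subsetsOf (true ∷ S) ≡ map (outside ∷_) (subsetsOf S) ++ map (inside ∷_) (subsetsOf S)
subsetsOf-inside {n} S = trans (filter-allSubsets n (_⊆? (true ∷ S)))
  (cong₂ (λ xs ys → map (outside ∷_) xs ++ map (inside ∷_) ys)
         (filter-does-cong (λ _ → refl) (allSubsets n)) (filter-does-cong (λ _ → refl) (allSubsets n)))

inclusionExclusion : ∀ {n} → Vec Bool n → (Vec Bool n → ℕ) → ℤ
inclusionExclusion S g = sumℤ (map (λ T → sign (∣ S ∣ ∸ ∣ T ∣) * + g T) (subsetsOf S))

inclusionExclusion-cong : ∀ {n} (S : Vec Bool n) {g g′} → g ≗ g′ → inclusionExclusion S g ≡ inclusionExclusion S g′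
inclusionExclusion-cong S g≗g′ =
  cong sumℤ (map-cong (λ T → cong (λ e → sign (∣ S ∣ ∸ ∣ T ∣) * + e) (g≗g′ T)) (subsetsOf S))

inclusionExclusion-* : ∀ {n} (S : Vec Bool n) k g → inclusionExclusion S (λ T → k ℕ.* g T) ≡ + k * inclusionExclusion S g
inclusionExclusion-* S k g = trans (cong sumℤ (map-cong pull-out (subsetsOf S)))
                                   (sumℤ-commute (+ k *_) (ℤ.*-zeroʳ (+ k)) (ℤ.*-distribˡ-+ (+ k)) _ (subsetsOf S))
  where
  pull-out : ∀ T → sign (∣ S ∣ ∸ ∣ T ∣) * + (k ℕ.* g T) ≡ + k * (sign (∣ S ∣ ∸ ∣ T ∣) * + g T)
  pull-out T = trans (cong (sign (∣ S ∣ ∸ ∣ T ∣) *_) (ℤ.pos-* k (g T))) (swap (sign (∣ S ∣ ∸ ∣ T ∣)) (+ k) (+ g T))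
    where
    swap : ∀ s x y → s * (x * y) ≡ x * (s * y)
    swap = solve-∀

inclusionExclusion-outside : ∀ {n} (S : Vec Bool n) g →
  inclusionExclusion (false ∷ S) g ≡ inclusionExclusion S (g ∘ (outside ∷_))
inclusionExclusion-outside {n} S g = begin
  sumℤ (map φ (subsetsOf (false ∷ S)))           ≡⟨ cong (sumℤ ∘ map φ) (subsetsOf-outside S) ⟩
  sumℤ (map φ (map (outside ∷_) (subsetsOf S)))  ≡⟨ cong sumℤ (sym (map-∘ (subsetsOf S))) ⟩
  inclusionExclusion S (g ∘ (outside ∷_))        ∎
  where
  φ : Vec Bool (suc n) → ℤ
  φ T = sign (∣ S ∣ ∸ ∣ T ∣) * + g T

inclusionExclusion-inside : ∀ {n} (S : Vec Bool n) g →
  inclusionExclusion (true ∷ S) g ≡ - inclusionExclusion S (g ∘ (outside ∷_)) + inclusionExclusion S (g ∘ (inside ∷_))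
inclusionExclusion-inside {n} S g = begin
  sumℤ (map φ (subsetsOf (true ∷ S)))
    ≡⟨ cong (sumℤ ∘ map φ) (subsetsOf-inside S) ⟩
  sumℤ (map φ (map (outside ∷_) L ++ map (inside ∷_) L))
    ≡⟨ sumℤ-map-++ φ (map (outside ∷_) L) (map (inside ∷_) L) ⟩
  sumℤ (map φ (map (outside ∷_) L)) + sumℤ (map φ (map (inside ∷_) L))
    ≡⟨ cong₂ _+_ (cong sumℤ (trans (sym (map-∘ L)) (map-cong-local (All.map sign-flip (all-filter (_⊆? S) (allSubsets n))))))
                 (cong sumℤ (sym (map-∘ L))) ⟩
  sumℤ (map (-_ ∘ ψ) L) + inclusionExclusion S (g ∘ (inside ∷_))
    ≡⟨ cong (_+ inclusionExclusion S (g ∘ (inside ∷_))) (sumℤ-commute -_ refl ℤ.neg-distrib-+ ψ L) ⟩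
  - inclusionExclusion S (g ∘ (outside ∷_)) + inclusionExclusion S (g ∘ (inside ∷_)) ∎
  where
  L : List (Vec Bool n)
  L = subsetsOf S
  φ : Vec Bool (suc n) → ℤ
  φ T = sign (suc ∣ S ∣ ∸ ∣ T ∣) * + g T
  ψ : Vec Bool n → ℤ
  ψ T = sign (∣ S ∣ ∸ ∣ T ∣) * + g (outside ∷ T)
  sign-flip : ∀ {T} → T ⊆ S → φ (outside ∷ T) ≡ - ψ T
  sign-flip {T} T⊆S = begin
    sign (suc ∣ S ∣ ∸ ∣ T ∣) * + g (outside ∷ T)
      ≡⟨ cong (λ e → sign e * + g (outside ∷ T)) (+-∸-assoc 1 (p⊆q⇒∣p∣≤∣q∣ T⊆S)) ⟩
    - sign (∣ S ∣ ∸ ∣ T ∣) * + g (outside ∷ T)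
      ≡⟨ sym (ℤ.neg-distribˡ-* (sign (∣ S ∣ ∸ ∣ T ∣)) (+ g (outside ∷ T))) ⟩
    - ψ T ∎

flagHRec : ∀ {p} → ℕ → ℕ → ℕ → Vec Bool p → ℤ
flagHRec m r k []          = + 1
flagHRec m r k (false ∷ S) = flagHRec m r (suc k) S
flagHRec m r k (true  ∷ S) = + ((m ∸ r) C (suc k ∸ r)) * flagHRec m (suc k) (suc k) S - flagHRec m r (suc k) S

inclusionExclusion-chainCount : ∀ {p} (S : Vec Bool p) m r k →
  inclusionExclusion S (chainCount m r k) ≡ flagHRec m r k S
inclusionExclusion-chainCount []          m r k = refl
inclusionExclusion-chainCount (false ∷ S) m r k =
  trans (inclusionExclusion-outside S (chainCount m r k)) (inclusionExclusion-chainCount S m r (suc k))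
inclusionExclusion-chainCount (true  ∷ S) m r k = begin
  inclusionExclusion (true ∷ S) (chainCount m r k)
    ≡⟨ inclusionExclusion-inside S (chainCount m r k) ⟩
  - inclusionExclusion S (chainCount m r (suc k)) + inclusionExclusion S (λ T → c₀ ℕ.* chainCount m (suc k) (suc k) T)
    ≡⟨ cong₂ (λ s t → - s + t) (inclusionExclusion-chainCount S m r (suc k))
             (trans (inclusionExclusion-* S c₀ (chainCount m (suc k) (suc k)))
                    (cong (+ c₀ *_) (inclusionExclusion-chainCount S m (suc k) (suc k)))) ⟩
  - flagHRec m r (suc k) S + + c₀ * flagHRec m (suc k) (suc k) S
    ≡⟨ ℤ.+-comm (- flagHRec m r (suc k) S) _ ⟩
  flagHRec m r k (true ∷ S) ∎
  where
  c₀ : ℕ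
  c₀ = (m ∸ r) C (suc k ∸ r)

flagH-flagHRec : ∀ n (S : Vec Bool n) → flagH n S ≡ flagHRec (suc n) 0 0 S
flagH-flagHRec n S = trans (inclusionExclusion-cong S (flagF-chainCount n)) (inclusionExclusion-chainCount S (suc n) 0 0)

-- upper intervals of Boolean lattices are Boolean: only rank differences matter
flagHRec-shift : ∀ {p} (S : Vec Bool p) m r k s → flagHRec (m ℕ.+ s) (r ℕ.+ s) (k ℕ.+ s) S ≡ flagHRec m r k S
flagHRec-shift []          m r k s = refl
flagHRec-shift (false ∷ S) m r k s = flagHRec-shift S m r (suc k) s
flagHRec-shift (true  ∷ S) m r k s =
  cong₂ _-_ (cong₂ (λ c h → + c * h) (cong₂ _C_ (∸-+ m) (∸-+ (suc k))) (flagHRec-shift S m (suc k) (suc k) s))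
            (flagHRec-shift S m r (suc k) s)
  where
  ∸-+ : ∀ n → (n ℕ.+ s) ∸ (r ℕ.+ s) ≡ n ∸ r
  ∸-+ n = trans (cong₂ _∸_ (ℕ.+-comm n s) (ℕ.+-comm r s)) (ℕ.[m+n]∸[m+o]≡n∸o s n r)

flagHRec-abΨB-a∷ : ∀ {p} (w : Vec AB p) k →
  flagHRec (suc (suc k ℕ.+ p)) 0 (suc k) (abToSet w) ≡ abΨB (suc k ℕ.+ p) (a^ suc k ++ toList w) →
  flagHRec (suc (k ℕ.+ suc p)) 0 (suc k) (abToSet w) ≡ abΨB (k ℕ.+ suc p) (a^ k ++ a ∷ toList w)
flagHRec-abΨB-a∷ {p} w k eq = begin
  flagHRec (suc (k ℕ.+ suc p)) 0 (suc k) (abToSet w)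
    ≡⟨ cong (λ n → flagHRec (suc n) 0 (suc k) (abToSet w)) (ℕ.+-suc k p) ⟩
  flagHRec (suc (suc k ℕ.+ p)) 0 (suc k) (abToSet w)
    ≡⟨ eq ⟩
  abΨB (suc k ℕ.+ p) (a^ suc k ++ toList w)
    ≡⟨ cong₂ abΨB (sym (ℕ.+-suc k p)) (sym (a^-++-a∷ k (toList w))) ⟩
  abΨB (k ℕ.+ suc p) (a^ k ++ a ∷ toList w) ∎

flagHRec-abΨB : ∀ {p} (w : Vec AB p) k → flagHRec (suc (k ℕ.+ p)) 0 k (abToSet w) ≡ abΨB (k ℕ.+ p) (a^ k ++ toList w)
flagHRec-abΨB []      k = sym (begin
  abΨB (k ℕ.+ 0) (a^ k ++ [])  ≡⟨ cong₂ abΨB (ℕ.+-identityʳ k) (++-identityʳ (a^ k)) ⟩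
  abΨB k (a^ k)                ≡⟨ abΨB-a^ k ⟩
  + 1                          ∎)
flagHRec-abΨB (a ∷ w) k = flagHRec-abΨB-a∷ w k (flagHRec-abΨB w (suc k))
flagHRec-abΨB {suc p} (b ∷ w) k = begin
  + (suc n C suc k) * flagHRec (suc n) (suc k) (suc k) S - flagHRec (suc n) 0 (suc k) S
    ≡⟨ cong₂ (λ h h′ → + (suc n C suc k) * h - h′) upper (flagHRec-abΨB-a∷ w k (flagHRec-abΨB w (suc k))) ⟩
  + (suc n C suc k) * abΨB p W - abΨB n (a^ k ++ a ∷ W)
    ≡⟨ sym (solve-for-right _ _ _ factorises) ⟩
  abΨB n (a^ k ++ b ∷ W) ∎
  where
  n : ℕ
  n = k ℕ.+ suc p
  S : Vec Bool p
  S = abToSet w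
  W : List AB
  W = toList w
  upper : flagHRec (suc n) (suc k) (suc k) S ≡ abΨB p W
  upper = begin
    flagHRec (suc n) (suc k) (suc k) S
      ≡⟨ cong (λ m → flagHRec m (suc k) (suc k) S) (ℕ.+-comm (suc k) (suc p)) ⟩
    flagHRec (suc p ℕ.+ suc k) (0 ℕ.+ suc k) (0 ℕ.+ suc k) S
      ≡⟨ flagHRec-shift S (suc p) 0 0 (suc k) ⟩
    flagHRec (suc p) 0 0 S
      ≡⟨ flagHRec-abΨB w 0 ⟩
    abΨB p W ∎
  factorises : abΨB n (a^ k ++ a ∷ W) + abΨB n (a^ k ++ b ∷ W) ≡ + (suc n C suc k) * abΨB p W
  factorises = trans (abΨB-factorises n k W (cong (λ l → k ℕ.+ suc l) (sym (length-toList w))))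
                     (cong (λ l → + (suc n C suc k) * abΨB l W) (length-toList w))
  solve-for-right : ∀ x y z → x + y ≡ z → y ≡ z - x
  solve-for-right x y z refl = solve x y
    where
    solve : ∀ x y → y ≡ (x + y) - x
    solve = solve-∀

abIndexB-abΨB : ∀ n (w : Vec AB n) → abIndexB n w ≡ abΨB n (toList w)
abIndexB-abΨB n w = trans (flagH-flagHRec n (abToSet w)) (flagHRec-abΨB w 0)

-- Uniqueness of the cd-index

expandCD-expand : ∀ n f (w : Vec AB n) → expandCD n f w ≡ expand f (toList w)
expandCD-expand zero          f []          = trans (+-identityʳ _) (ℤ.*-identityʳ _)
expandCD-expand (suc zero)    f (x ∷ [])    = trans (+-identityʳ _) (ℤ.*-identityʳ _)
expandCD-expand (suc (suc n)) f (x ∷ y ∷ w) = begin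
  sumℤ (map g (map (c ∷_) (cdWords (suc n)) ++ map (d ∷_) (cdWords n)))
    ≡⟨ sumℤ-map-++ g (map (c ∷_) (cdWords (suc n))) (map (d ∷_) (cdWords n)) ⟩
  sumℤ (map g (map (c ∷_) (cdWords (suc n)))) + sumℤ (map g (map (d ∷_) (cdWords n)))
    ≡⟨ cong₂ _+_ (trans (cong sumℤ (sym (map-∘ (cdWords (suc n))))) (expandCD-expand (suc n) (f ∘ (c ∷_)) (y ∷ w)))
                 (trans (cong sumℤ (sym (map-∘ (cdWords n)))) (d-part x y)) ⟩
  expand f (toList (x ∷ y ∷ w)) ∎
  where
  g : List CD → ℤ
  g v = f v * expCoeff v (x ∷ y ∷ w)
  no-d-part : sumℤ (map (λ v → f (d ∷ v) * + 0) (cdWords n)) ≡ + 0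
  no-d-part = trans (sumℤ-commute (_* + 0) refl (λ s t → ℤ.*-distribʳ-+ (+ 0) s t) (f ∘ (d ∷_)) (cdWords n))
                    (ℤ.*-zeroʳ (sumℤ (map (f ∘ (d ∷_)) (cdWords n))))
  d-part : ∀ x y → sumℤ (map (λ v → f (d ∷ v) * expCoeff (d ∷ v) (x ∷ y ∷ w)) (cdWords n))
                   ≡ ifDistinct x y (expand (f ∘ (d ∷_)) (toList w))
  d-part a a = no-d-part
  d-part a b = expandCD-expand n (f ∘ (d ∷_)) w
  d-part b a = expandCD-expand n (f ∘ (d ∷_)) w
  d-part b b = no-d-part

expand-c∷-agree : ∀ {n} F G → (∀ (w : Vec AB (suc (suc n))) → expand F (toList w) ≡ expand G (toList w)) →
                  ∀ y (w : Vec AB n) → expand (F ∘ (c ∷_)) (y ∷ toList w) ≡ expand (G ∘ (c ∷_)) (y ∷ toList w)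
expand-c∷-agree F G eq y w = begin
  expand (F ∘ (c ∷_)) (y ∷ W)
    ≡⟨ sym (+-identityʳ _) ⟩
  expand (F ∘ (c ∷_)) (y ∷ W) + + 0
    ≡⟨ cong (_+_ (expand (F ∘ (c ∷_)) (y ∷ W))) (sym (ifDistinct-same y _)) ⟩
  expand F (y ∷ y ∷ W)
    ≡⟨ eq (y ∷ y ∷ w) ⟩
  expand (G ∘ (c ∷_)) (y ∷ W) + ifDistinct y y (expand (G ∘ (d ∷_)) W)
    ≡⟨ cong (_+_ (expand (G ∘ (c ∷_)) (y ∷ W))) (ifDistinct-same y _) ⟩
  expand (G ∘ (c ∷_)) (y ∷ W) + + 0
    ≡⟨ +-identityʳ _ ⟩
  expand (G ∘ (c ∷_)) (y ∷ W) ∎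
  where
  W : List AB
  W = toList w

expand-injective : ∀ n F G → (∀ (w : Vec AB n) → expand F (toList w) ≡ expand G (toList w)) →
                   ∀ v → deg v ≡ n → F v ≡ G v
expand-injective zero          F G eq []          _  = eq []
expand-injective (suc zero)    F G eq (c ∷ [])    _  = eq (a ∷ [])
expand-injective (suc (suc n)) F G eq (c ∷ v)     dv =
  expand-injective (suc n) (F ∘ (c ∷_)) (G ∘ (c ∷_)) (λ { (y ∷ w) → expand-c∷-agree F G eq y w }) v (suc-injective dv)
expand-injective (suc (suc n)) F G eq (d ∷ v)     dv =
  expand-injective n (F ∘ (d ∷_)) (G ∘ (d ∷_)) d-part v (suc-injective (suc-injective dv))
  where
  -- the expansion at a ∷ b ∷ w is the c-part, already matched at b ∷ b ∷ w, plus the d-part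
  d-part : ∀ (w : Vec AB n) → expand (F ∘ (d ∷_)) (toList w) ≡ expand (G ∘ (d ∷_)) (toList w)
  d-part w = ∙-cancelˡ (expand (F ∘ (c ∷_)) (b ∷ toList w)) _ _
    (trans (eq (a ∷ b ∷ w)) (cong (_+ expand (G ∘ (d ∷_)) (toList w)) (sym (expand-c∷-agree F G eq b w))))
expand-injective zero          F G eq (c ∷ _)     ()
expand-injective zero          F G eq (d ∷ _)     ()
expand-injective (suc zero)    F G eq []          ()
expand-injective (suc zero)    F G eq (c ∷ c ∷ _) ()
expand-injective (suc zero)    F G eq (c ∷ d ∷ _) ()
expand-injective (suc zero)    F G eq (d ∷ _)     ()
expand-injective (suc (suc n)) F G eq []          ()

cdIndexB-unique : ∀ n β → IsCDIndexB n β → ∀ v → deg v ≡ n → β v ≡ + ΨB n v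
cdIndexB-unique n β isCD = expand-injective n β (+_ ∘ ΨB n) λ w → begin
  expand β (toList w)  ≡⟨ sym (expandCD-expand n β w) ⟩
  expandCD n β w       ≡⟨ isCD w ⟩
  abIndexB n w         ≡⟨ abIndexB-abΨB n w ⟩
  abΨB n (toList w)    ∎

deg-cc : ∀ u v → deg (u ++ c ∷ c ∷ v) ≡ deg (u ++ d ∷ v)
deg-cc []      v = refl
deg-cc (c ∷ u) v = cong suc (deg-cc u v)
deg-cc (d ∷ u) v = cong (suc ∘ suc) (deg-cc u v)

ΨB-d≡cc : ∀ {n} → 2 ≡ n → ΨB n (d ∷ []) ≡ ΨB n (c ∷ c ∷ [])
ΨB-d≡cc refl = refl

lemma3p14 : (n : ℕ) (β : List CD → ℤ) → IsCDIndexB n β →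
    (u v : List CD) → deg (u ++ d ∷ v) ≡ n →
    (β (u ++ c ∷ c ∷ v) ≤ β (u ++ d ∷ v))
    × (u ≡ [] → v ≡ [] → β (u ++ d ∷ v) ≡ β (u ++ c ∷ c ∷ v))
lemma3p14 n β isCD u v deg≡n = cc≤d , d≡cc
  where
  β≡ΨB : ∀ w → deg w ≡ n → β w ≡ + ΨB n w
  β≡ΨB = cdIndexB-unique n β isCD
  cc≤d : β (u ++ c ∷ c ∷ v) ≤ β (u ++ d ∷ v)
  cc≤d = subst₂ _≤_ (sym (β≡ΨB _ (trans (deg-cc u v) deg≡n))) (sym (β≡ΨB _ deg≡n)) (+≤+ (ΨB-cc≤d n u v))
  d≡cc : u ≡ [] → v ≡ [] → β (u ++ d ∷ v) ≡ β (u ++ c ∷ c ∷ v)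
  d≡cc refl refl = trans (β≡ΨB _ deg≡n) (trans (cong +_ (ΨB-d≡cc deg≡n)) (sym (β≡ΨB _ deg≡n)))
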